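{- Let $k\geq3$ and $n\geq 3$. If $[a_0,a_1,\dots,a_{n-1}]$ is a circuit in $\mathcal{C}_k(n-1)$, then $[-a_0,-a_1,\dots,-a_{n-1}]$ is also a circuit in $\mathcal{C}_k(n-1)$. Moreover, if $[a_0,a_1,\dots,a_{n-1}]$ is non-negasymmetric, then the circuit $[-a_{n-1},-a_{n-2},\dots,-a_{0}]$ is also non-negasymmetric, and $[a_0,a_1,\dots,a_{n-1}]$ shares no edges with $[-a_{n-1},-a_{n-2},\dots,-a_{0}]$.
   Context: Tuples are $k$-ary (entries in $\mathbb{Z}_k$), negation is modulo $k$, $\mathbf{u}^R$ is the reverse of $\mathbf{u}$. The pseudoweight of $a\in\mathbb{Z}_k$ is $a$ if $a\ne0$ and $k/2$ if $a=0$, and of a tuple the sum over its entries. $B_k(n-1)$ is the de Bruijn digraph with vertices the $k$-ary $(n-1)$-tuples and edges the $k$-ary $n$-tuples $(a_0,\dots,a_{n-1})$ from $(a_0,\dots,a_{n-2})$ to $(a_1,\dots,a_{n-1})$; $H_k(n-1)$ is its subgraph of edges of pseudoweight exactly $kn/2$. For an $n$-tuple $(a_0,\dots,a_{n-1})$, with $p$ the least positive $c$ such that $a_i=a_{(i+c)\bmod n}$ for all $i$, $[a_0,\dots,a_{n-1}]$ is the circuit whose edges are the $p$ cyclic shifts $(a_j,\dots,a_{j+n-1})$ (indices mod $n$), $0\le j<p$. $\mathcal{C}_k(n-1)$ is the set of such circuits arising from edges of $H_k(n-1)$. A circuit is negasymmetric if it contains edges $\mathbf a,\mathbf b$ (not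 necessarily distinct) with $\mathbf a=-\mathbf b^R$, and non-negasymmetric otherwise. -}

module Defs where

open import Data.Nat using (ℕ; zero; suc; _+_; _*_; _<_)
open import Data.Fin using (Fin; zero; suc; toℕ; opposite; inject₁)
open import Data.Vec using (Vec; []; _∷_; _∷ʳ_; map; reverse; sum)
open import Data.Product using (Σ; ∃; _×_)
open import Relation.Binary.PropositionalEquality using (_≡_; _≢_)
open import Relation.Nullary using (¬_)
open import Function.Bundles using (_⇔_)

Tuple : ℕ → ℕ → Set
Tuple k n = Vec (Fin k) n

negZ : ∀ {k} → Fin k → Fin k
negZ {suc m} zero = zero
negZ {suc m} (suc i) = opposite (inject₁ i)   -- value (suc m) - (1 + i)

negT : ∀ {k n} → Tuple k n → Tuple k n
negT = map negZ

-- twice the pseudoweight of an entry: 2a if a ≠ 0, k if a = 0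
pw2 : ∀ {k} → Fin k → ℕ
pw2 {k} zero = k
pw2 {k} (suc i) = 2 * toℕ (suc i)

pw2T : ∀ {k n} → Tuple k n → ℕ
pw2T t = sum (map pw2 t)

-- edge of H_k(n-1): pseudoweight exactly kn/2, i.e. twice the pseudoweight = k n
InH : ∀ {k n} → Tuple k n → Set
InH {k} {n} t = pw2T t ≡ k * n

shift : ∀ {A : Set} {n} → Vec A n → Vec A n
shift [] = []
shift (x ∷ xs) = xs ∷ʳ x

rot : ∀ {A : Set} {n} → ℕ → Vec A n → Vec A n
rot zero a = a
rot (suc j) a = rot j (shift a)

IsPeriod : ∀ {A : Set} {n} → ℕ → Vec A n → Set
IsPeriod c a = rot c a ≡ a

IsLeastPeriod : ∀ {A : Set} {n} → ℕ → Vec A n → Set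
IsLeastPeriod p a = 0 < p × IsPeriod p a × (∀ c → 0 < c → c < p → ¬ IsPeriod c a)

-- e is an edge of the circuit [a]: e is one of the p cyclic shifts rot j a, 0 ≤ j < p
_∈C_ : ∀ {k n} → Tuple k n → Tuple k n → Set
e ∈C a = ∃ λ p → IsLeastPeriod p a × ∃ λ j → j < p × e ≡ rot j a

SameCircuit : ∀ {k n} → Tuple k n → Tuple k n → Set
SameCircuit {k} {n} a b = ∀ (x : Tuple k n) → (x ∈C a) ⇔ (x ∈C b)

-- [a] ∈ 𝒞_k(n-1): [a] is the circuit [e] for some edge e of H_k(n-1)
InCircuits : ∀ {k n} → Tuple k n → Set
InCircuits {k} {n} a = ∃ λ (e : Tuple k n) → InH e × SameCircuit e a

Negasymmetric : ∀ {k n} → Tuple k n → Set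
Negasymmetric {k} {n} a =
  ∃ λ (x : Tuple k n) → ∃ λ (y : Tuple k n) → x ∈C a × y ∈C a × x ≡ negT (reverse y)

NonNegasymmetric : ∀ {k n} → Tuple k n → Set
NonNegasymmetric a = ¬ Negasymmetric a

{-# OPTIONS --safe #-}
module Submission where

-- For every entry, pw(x) + pw(-x) = k, so negating an edge of H_k(n-1) gives an edge of H_k(n-1).
-- Both u ↦ -u and u ↦ -u^R are involutions that preserve periods and send rotations of a to
-- rotations of the image (reverse (rot j a) = rot (n - j) (reverse a)), so they map the circuit
-- [a] onto the circuit of the image. Hence a witness pair for negasymmetry of [-a^R] is carried
-- back to one for [a], and a shared edge e of [a] and [-a^R] puts -e^R in [a], making (e, -e^R)
-- such a pair.

open import Defs
open import Data.Nat using (ℕ; zero; suc; _+_; _*_; _∸_; _≤_; _<_; z<s; s≤s; NonZero; >-nonZero)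
open import Data.Nat.Properties
open import Algebra.Properties.CommutativeSemigroup +-commutativeSemigroup using (interchange)
open import Data.Nat.DivMod using (_%_; _/_; m≡m%n+[m/n]*n; m%n<n)
open import Data.Nat.Tactic.RingSolver using (solve-∀)
open import Data.Fin using (Fin; toℕ; inject₁)
import Data.Fin.Properties as Fin
open import Data.Vec using (Vec; []; _∷_; _∷ʳ_; map; reverse; toList)
import Data.Vec.Properties as Vec
open import Data.List as List using (List; length; _++_; [_])
import Data.List.Properties as List
open import Data.Product using (∃; _×_; _,_)
open import Function using (_∘_)
open import Function.Bundles using (mk⇔; Equivalence)
open import Relation.Binary.PropositionalEquality using (_≡_; refl; sym; trans; cong; cong₂; subst; module ≡-Reasoning)
open import Relation.Nullary using (¬_)

private variable
  A B : Set
  m n : ℕ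

rot-shift : ∀ j (a : Vec A n) → rot j (shift a) ≡ shift (rot j a)
rot-shift zero    a = refl
rot-shift (suc j) a = rot-shift j (shift a)

rot-+ : ∀ i j (a : Vec A n) → rot (i + j) a ≡ rot i (rot j a)
rot-+ zero    j a = refl
rot-+ (suc i) j a = trans (rot-+ i j (shift a)) (cong (rot i) (rot-shift j a))

shift-map : ∀ (f : A → B) (a : Vec A n) → shift (map f a) ≡ map f (shift a)
shift-map f []       = refl
shift-map f (x ∷ xs) = sym (Vec.map-∷ʳ f x xs)

rot-map : ∀ (f : A → B) j (a : Vec A n) → rot j (map f a) ≡ map f (rot j a)
rot-map f zero    a = refl
rot-map f (suc j) a = trans (cong (rot j) (shift-map f a)) (rot-map f j (shift a))

-- The length index of Vec gets in the way of an induction over xs ++ ys, so rot n a ≡ a is proved on lists.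
private
  shiftL : List A → List A
  shiftL List.[]       = List.[]
  shiftL (x List.∷ xs) = xs ++ [ x ]

  rotL : ℕ → List A → List A
  rotL zero    xs = xs
  rotL (suc j) xs = rotL j (shiftL xs)

  toList-rot : ∀ j (a : Vec A n) → toList (rot j a) ≡ rotL j (toList a)
  toList-rot zero    a        = refl
  toList-rot (suc j) []       = toList-rot j []
  toList-rot (suc j) (x ∷ xs) =
    trans (toList-rot j (xs ∷ʳ x)) (cong (rotL j) (Vec.toList-∷ʳ x xs))

  rotL-++ : ∀ (xs ys : List A) → rotL (length xs) (xs ++ ys) ≡ ys ++ xs
  rotL-++ List.[]       ys = sym (List.++-identityʳ ys)
  rotL-++ (x List.∷ xs) ys = begin
    rotL (length xs) ((xs ++ ys) ++ [ x ]) ≡⟨ cong (rotL (length xs)) (List.++-assoc xs ys [ x ]) ⟩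
    rotL (length xs) (xs ++ (ys ++ [ x ])) ≡⟨ rotL-++ xs (ys ++ [ x ]) ⟩
    (ys ++ [ x ]) ++ xs                    ≡⟨ List.++-assoc ys [ x ] xs ⟩
    ys ++ (x List.∷ xs)                    ∎
    where open ≡-Reasoning

rot-length : (a : Vec A n) → rot n a ≡ a
rot-length {n = n} a = trans (sym (Vec.cast-is-id refl (rot n a)))
  (Vec.toList-injective refl (rot n a) a (begin
    toList (rot n a)                      ≡⟨ toList-rot n a ⟩
    rotL n l                              ≡⟨ cong (λ i → rotL i l) (Vec.length-toList a) ⟨
    rotL (length l) l                     ≡⟨ cong (rotL (length l)) (List.++-identityʳ l) ⟨
    rotL (length l) (l ++ List.[])        ≡⟨ rotL-++ l List.[] ⟩
    l                                     ∎))
  where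
  open ≡-Reasoning
  l : List _
  l = toList a

shift-reverse-shift : (a : Vec A n) → shift (reverse (shift a)) ≡ reverse a
shift-reverse-shift []       = refl
shift-reverse-shift (x ∷ xs) = begin
  shift (reverse (xs ∷ʳ x))                     ≡⟨ cong (λ ys → shift (reverse (ys ∷ʳ x))) (sym (Vec.reverse-involutive xs)) ⟩
  shift (reverse (reverse (reverse xs) ∷ʳ x))   ≡⟨ cong (shift ∘ reverse) (sym (Vec.reverse-∷ x (reverse xs))) ⟩
  shift (reverse (reverse (x ∷ reverse xs)))    ≡⟨ cong shift (Vec.reverse-involutive (x ∷ reverse xs)) ⟩
  reverse xs ∷ʳ x                               ≡⟨ Vec.reverse-∷ x xs ⟨
  reverse (x ∷ xs)                              ∎
  where open ≡-Reasoning

rot-reverse-rot : ∀ j (a : Vec A n) → rot j (reverse (rot j a)) ≡ reverse a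
rot-reverse-rot zero    a = refl
rot-reverse-rot (suc j) a = begin
  rot j (shift (reverse (rot j (shift a))))   ≡⟨ rot-shift j _ ⟩
  shift (rot j (reverse (rot j (shift a))))   ≡⟨ cong shift (rot-reverse-rot j (shift a)) ⟩
  shift (reverse (shift a))                   ≡⟨ shift-reverse-shift a ⟩
  reverse a                                   ∎
  where open ≡-Reasoning

reverse-rot : ∀ j (a : Vec A n) → j ≤ n → reverse (rot j a) ≡ rot (n ∸ j) (reverse a)
reverse-rot {n = n} j a j≤n = begin
  reverse (rot j a)                            ≡⟨ rot-length _ ⟨
  rot n (reverse (rot j a))                    ≡⟨ cong (λ i → rot i (reverse (rot j a))) (m∸n+n≡m j≤n) ⟨
  rot (n ∸ j + j) (reverse (rot j a))          ≡⟨ rot-+ (n ∸ j) j _ ⟩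
  rot (n ∸ j) (rot j (reverse (rot j a)))      ≡⟨ cong (rot (n ∸ j)) (rot-reverse-rot j a) ⟩
  rot (n ∸ j) (reverse a)                      ∎
  where open ≡-Reasoning

IsPeriod-* : ∀ q {p} {a : Vec A n} → IsPeriod p a → IsPeriod (q * p) a
IsPeriod-* zero            per = refl
IsPeriod-* (suc q) {p} {a} per =
  trans (rot-+ p (q * p) a) (trans (cong (rot p) (IsPeriod-* q per)) per)

rot-%-period : ∀ {p} {a : Vec A n} .{{_ : NonZero p}} → IsPeriod p a →
               ∀ j → rot j a ≡ rot (j % p) a
rot-%-period {p = p} {a} per j = begin
  rot j a                          ≡⟨ cong (λ i → rot i a) (m≡m%n+[m/n]*n j p) ⟩
  rot (j % p + j / p * p) a        ≡⟨ rot-+ (j % p) (j / p * p) a ⟩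
  rot (j % p) (rot (j / p * p) a)  ≡⟨ cong (rot (j % p)) (IsPeriod-* (j / p) per) ⟩
  rot (j % p) a                    ∎
  where open ≡-Reasoning

IsLeastPeriod⇒≤length : ∀ {p} {a : Vec A n} → 0 < n → IsLeastPeriod p a → p ≤ n
IsLeastPeriod⇒≤length {a = a} n>0 (_ , _ , least) =
  ≮⇒≥ (λ n<p → least _ n>0 n<p (rot-length a))

rot∈C : ∀ {k p} {a : Tuple k n} → IsLeastPeriod p a → ∀ j → rot j a ∈C a
rot∈C {p = p} lp@(p>0 , per , _) j =
  p , lp , j % p , m%n<n j p , rot-%-period per j
  where instance
    p≢0 : NonZero p
    p≢0 = >-nonZero p>0

record RotationSymmetry (f : Vec A n → Vec A n) : Set where
  field
    involutive       : ∀ a → f (f a) ≡ a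
    preserves-period : ∀ c a → IsPeriod c a → IsPeriod c (f a)
    rot-image        : ∀ j a → j ≤ n → ∃ λ i → f (rot j a) ≡ rot i (f a)

  reflects-period : ∀ c a → IsPeriod c (f a) → IsPeriod c a
  reflects-period c a per = subst (IsPeriod c) (involutive a) (preserves-period c (f a) per)

  preserves-least-period : ∀ {p a} → IsLeastPeriod p a → IsLeastPeriod p (f a)
  preserves-least-period {p} {a} (p>0 , per , least) =
    p>0 , preserves-period p a per , λ c c>0 c<p → least c c>0 c<p ∘ reflects-period c a

module _ {k n : ℕ} {f : Tuple k n → Tuple k n} (symm : RotationSymmetry f) (n>0 : 0 < n) where
  open RotationSymmetry symm

  ∈C-map : ∀ {x a} → x ∈C a → f x ∈C f a
  ∈C-map {a = a} (p , lp , j , j<p , refl)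
    with i , fx≡rot ← rot-image j a (<⇒≤ (<-≤-trans j<p (IsLeastPeriod⇒≤length n>0 lp)))
    = subst (_∈C f a) (sym fx≡rot) (rot∈C (preserves-least-period lp) i)

  ∈C-transposeˡ : ∀ {x a} → x ∈C f a → f x ∈C a
  ∈C-transposeˡ {a = a} = subst (_ ∈C_) (involutive a) ∘ ∈C-map

  ∈C-transposeʳ : ∀ {x a} → f x ∈C a → x ∈C f a
  ∈C-transposeʳ {x} = subst (_∈C _) (involutive x) ∘ ∈C-map

  SameCircuit-map : ∀ {e a} → SameCircuit e a → SameCircuit (f e) (f a)
  SameCircuit-map e≈a x = mk⇔
    (∈C-transposeʳ ∘ Equivalence.to   (e≈a (f x)) ∘ ∈C-transposeˡ)
    (∈C-transposeʳ ∘ Equivalence.from (e≈a (f x)) ∘ ∈C-transposeˡ)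

toℕ-negZ : (y : Fin (suc m)) → 0 < toℕ y → toℕ (negZ y) ≡ suc m ∸ toℕ y
toℕ-negZ {m} (Fin.suc i) _ = trans (Fin.opposite-prop (inject₁ i)) (cong (m ∸_) (Fin.toℕ-inject₁ i))

0<toℕ-negZ : (y : Fin (suc m)) → 0 < toℕ y → 0 < toℕ (negZ y)
0<toℕ-negZ y y>0 = subst (0 <_) (sym (toℕ-negZ y y>0)) (m<n⇒0<n∸m (Fin.toℕ<n y))

negZ-involutive : (y : Fin (suc m)) → negZ (negZ y) ≡ y
negZ-involutive Fin.zero = refl
negZ-involutive {m} y@(Fin.suc _) = Fin.toℕ-injective (begin
  toℕ (negZ (negZ y))          ≡⟨ toℕ-negZ (negZ y) (0<toℕ-negZ y z<s) ⟩
  suc m ∸ toℕ (negZ y)         ≡⟨ cong (suc m ∸_) (toℕ-negZ y z<s) ⟩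
  suc m ∸ (suc m ∸ toℕ y)      ≡⟨ m∸[m∸n]≡n (Fin.toℕ≤n y) ⟩
  toℕ y                        ∎)
  where open ≡-Reasoning

negT-involutive : ∀ (a : Tuple (suc m) n) → negT (negT a) ≡ a
negT-involutive []       = refl
negT-involutive (x ∷ xs) = cong₂ _∷_ (negZ-involutive x) (negT-involutive xs)

pw2-nonzero : ∀ {k} (y : Fin k) → 0 < toℕ y → pw2 y ≡ 2 * toℕ y
pw2-nonzero (Fin.suc _) _ = refl

pw2-negZ : (y : Fin (suc m)) → pw2 y + pw2 (negZ y) ≡ 2 * suc m
pw2-negZ {m} Fin.zero = cong (suc m +_) (sym (+-identityʳ (suc m)))
pw2-negZ {m} y@(Fin.suc _) = begin
  pw2 y + pw2 (negZ y)              ≡⟨ cong (pw2 y +_) (pw2-nonzero (negZ y) (0<toℕ-negZ y z<s)) ⟩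
  2 * toℕ y + 2 * toℕ (negZ y)      ≡⟨ cong (λ t → 2 * toℕ y + 2 * t) (toℕ-negZ y z<s) ⟩
  2 * toℕ y + 2 * (suc m ∸ toℕ y)   ≡⟨ *-distribˡ-+ 2 (toℕ y) _ ⟨
  2 * (toℕ y + (suc m ∸ toℕ y))     ≡⟨ cong (2 *_) (m+[n∸m]≡n (Fin.toℕ≤n y)) ⟩
  2 * suc m                         ∎
  where open ≡-Reasoning

pw2T-negT : (e : Tuple (suc m) n) → pw2T e + pw2T (negT e) ≡ n * (2 * suc m)
pw2T-negT []       = refl
pw2T-negT (x ∷ xs) = trans (interchange (pw2 x) (pw2T xs) (pw2 (negZ x)) (pw2T (negT xs)))
                           (cong₂ _+_ (pw2-negZ x) (pw2T-negT xs))

InH-negT : (e : Tuple (suc m) n) → InH e → InH (negT e)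
InH-negT {m} {n} e e∈H = +-cancelˡ-≡ (suc m * n) _ _ (begin
  suc m * n + pw2T (negT e)  ≡⟨ cong (_+ pw2T (negT e)) e∈H ⟨
  pw2T e + pw2T (negT e)     ≡⟨ pw2T-negT e ⟩
  n * (2 * suc m)            ≡⟨ double (suc m) n ⟩
  suc m * n + suc m * n      ∎)
  where
  open ≡-Reasoning
  double : ∀ k n → n * (2 * k) ≡ k * n + k * n
  double = solve-∀

negT-symmetry : RotationSymmetry (negT {suc m} {n})
negT-symmetry = record
  { involutive       = negT-involutive
  ; preserves-period = λ c a per → trans (rot-map negZ c a) (cong negT per)
  ; rot-image        = λ j a _ → j , sym (rot-map negZ j a)
  }

negRev : Tuple m n → Tuple m n
negRev = negT ∘ reverse

negRev-symmetry : RotationSymmetry (negRev {suc m} {n})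
negRev-symmetry {n = n} = record
  { involutive       = involutive
  ; preserves-period = preserves-period
  ; rot-image        = rot-image
  }
  where
  open ≡-Reasoning
  involutive : ∀ a → negRev (negRev a) ≡ a
  involutive a = begin
    negT (reverse (negT (reverse a)))  ≡⟨ cong negT (Vec.map-reverse negZ (reverse a)) ⟨
    negT (negT (reverse (reverse a)))  ≡⟨ negT-involutive _ ⟩
    reverse (reverse a)                ≡⟨ Vec.reverse-involutive a ⟩
    a                                  ∎
  preserves-period : ∀ c a → IsPeriod c a → IsPeriod c (negRev a)
  preserves-period c a per = begin
    rot c (negT (reverse a))           ≡⟨ rot-map negZ c (reverse a) ⟩
    negT (rot c (reverse a))           ≡⟨ cong (λ b → negT (rot c (reverse b))) per ⟨
    negT (rot c (reverse (rot c a)))   ≡⟨ cong negT (rot-reverse-rot c a) ⟩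
    negT (reverse a)                   ∎
  rot-image : ∀ j a → j ≤ n → ∃ λ i → negRev (rot j a) ≡ rot i (negRev a)
  rot-image j a j≤n = n ∸ j , (begin
    negT (reverse (rot j a))           ≡⟨ cong negT (reverse-rot j a j≤n) ⟩
    negT (rot (n ∸ j) (reverse a))     ≡⟨ rot-map negZ (n ∸ j) (reverse a) ⟨
    rot (n ∸ j) (negT (reverse a))     ∎)

module _ {m n : ℕ} (n>0 : 0 < n) where
  open RotationSymmetry (negRev-symmetry {m} {n})

  Negasymmetric-negRev⁻ : ∀ {a : Tuple (suc m) n} → Negasymmetric (negRev a) → Negasymmetric a
  Negasymmetric-negRev⁻ (x , y , x∈ , y∈ , x≡y') =
    negRev y , negRev x , ∈C-transposeˡ negRev-symmetry n>0 y∈ , ∈C-transposeˡ negRev-symmetry n>0 x∈ ,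
    trans (sym x≡y') (sym (involutive x))

  ∈C-negRev⇒Negasymmetric : ∀ {e a : Tuple (suc m) n} → e ∈C a → e ∈C negRev a → Negasymmetric a
  ∈C-negRev⇒Negasymmetric {e} e∈a e∈a' =
    e , negRev e , e∈a , ∈C-transposeˡ negRev-symmetry n>0 e∈a' , sym (involutive e)

lemma2p18 : (k n : ℕ) → 3 ≤ k → 3 ≤ n → (a : Tuple k n) →
    InCircuits a →
    InCircuits (negT a) ×
    (NonNegasymmetric a →
      NonNegasymmetric (negT (reverse a)) ×
      (∀ (e : Tuple k n) → e ∈C a → ¬ (e ∈C negT (reverse a))))
lemma2p18 (suc k) n (s≤s _) n≥3 a (h , h∈H , h≈a) =
  (negT h , InH-negT h h∈H , SameCircuit-map negT-symmetry n>0 h≈a) ,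
  λ non-nega → non-nega ∘ Negasymmetric-negRev⁻ n>0 ,
               λ e e∈a e∈a' → non-nega (∈C-negRev⇒Negasymmetric n>0 e∈a e∈a')
  where
  n>0 : 0 < n
  n>0 = <-≤-trans z<s n≥3
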